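{- Let $\ell$ be a positive integer and let $n\le 2^\ell$. For an $\ell$-bit integer $a$ let $h^0_a(x)=(ax\bmod 2^\ell)/2^\ell$, and let $a$ be drawn uniformly from the odd $\ell$-bit numbers. Then for any odd positive integer $x<n$ and any $\varepsilon<1/2$, \[\Pr_a\big[\|h^0_a(x)\|\le\varepsilon\big]\le 4\varepsilon,\] and if moreover $\varepsilon$ is a nonnegative integer multiple of $1/2^{\ell-1}$, then \[\Pr_a\big[\|h^0_a(x)\|\le\varepsilon\big]=2\varepsilon.\]
   Context: For real $y$, $\|y\|=\min\{y\bmod 1, -y\bmod 1\}$, the distance from $0$ in the circular unit interval.
   Formalization: The threshold ε ranges over the rationals. -}

module Defs where

open import Data.Nat as ℕ using (ℕ; zero; suc; _^_; _<_)
open import Data.Nat.DivMod using (_%_)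
open import Data.Nat.Properties using (m^n≢0)
open import Data.Integer as ℤ using (ℤ; +_)
open import Data.Rational as ℚ using (ℚ; _/_; floor; _-_; -_; _⊓_; 0ℚ; _≤_)
open import Data.Rational.Properties using (_≤?_)
open import Data.List using (List; []; _∷_; length; filter; applyUpTo)
open import Relation.Unary using (Pred; Decidable)
open import Level using (0ℓ)

mod1 : ℚ → ℚ
mod1 y = y - (floor y / 1)

‖_‖ : ℚ → ℚ
‖ y ‖ = mod1 y ⊓ mod1 (- y)

h0 : (ℓ a x : ℕ) → ℚ
h0 ℓ a x = _/_ (+ (_%_ (a ℕ.* x) (2 ^ ℓ) {{m^n≢0 2 ℓ}})) (2 ^ ℓ) {{m^n≢0 2 ℓ}}

oddLBit : ℕ → List ℕ
oddLBit ℓ = applyUpTo (λ k → suc (2 ℕ.* k)) (2 ^ (ℓ ℕ.∸ 1))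

-- probability of a decidable event when the sample is drawn uniformly
-- from a (nonempty) list; the empty list is given probability 0
Pr : (Ω : List ℕ) (P : Pred ℕ 0ℓ) → Decidable P → ℚ
Pr [] P P? = 0ℚ
Pr Ω@(_ ∷ _) P P? = (+ length (filter P? Ω)) / length Ω

Event : (ℓ x : ℕ) (ε : ℚ) → Pred ℕ 0ℓ
Event ℓ x ε a = ‖ h0 ℓ a x ‖ ≤ ε

event? : (ℓ x : ℕ) (ε : ℚ) → Decidable (Event ℓ x ε)
event? ℓ x ε a = ‖ h0 ℓ a x ‖ ≤? ε

PrEvent : (ℓ x : ℕ) (ε : ℚ) → ℚ
PrEvent ℓ x ε = Pr (oddLBit ℓ) (Event ℓ x ε) (event? ℓ x ε)

-- Write ℓ = l + 1 and N = 2 ^ ℓ = 2 M. The odd ℓ-bit numbers are the 1 + 2 i with i < M, and since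
-- an odd x is invertible modulo 2 ^ ℓ, a ↦ a x mod N permutes them. So the probability is the
-- proportion of odd residues r < N with ‖ r / N ‖ ≤ ε. For 0 < r < N, ‖ r / N ‖ is the smaller of r / N
-- and (N − r) / N; the reflection r ↦ N − r exchanges the two cases, and for ε < ½ they exclude each
-- other. Hence the count is 2 K, where K counts the odd r = 1 + 2 j with r ≤ ε N. Each of these has
-- j + 1 ≤ ε N, so K ≤ ε N and the probability 2 K / M is at most 4 ε; if ε N = 2 k, they are exactly
-- the r with j < k, so K = k and the probability is 2 k / M = 2 ε.
module Submission where

open import Defs
open import Level using (Level; 0ℓ)
open import Function.Base using (_∘_)
open import Function.Bundles using (_⇔_; Equivalence; mk⇔)
open import Data.Product using (∃; ∃₂; _,_; _×_)
open import Data.Sum using (_⊎_; inj₁; inj₂; [_,_])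
open import Data.Nat as ℕ
  using (ℕ; zero; suc; NonZero; _+_; _*_; _^_; _%_; _∸_; _⊓_; _≤_; _<_; z≤n; s≤s; _<?_)
import Data.Nat.Properties as ℕ
import Data.Nat.DivMod as ℕ
open import Data.Nat.Divisibility using (_∣_; divides)
open import Data.Nat.Tactic.RingSolver using (solve-∀)
open import Data.Integer as ℤ using (+_; -[1+_]; +≤+; +<+; -≤-)
import Data.Integer.Properties as ℤ
import Data.Integer.DivMod as ℤ
import Data.Integer.Tactic.RingSolver as ℤ-Solver
open import Data.Rational as ℚ using (ℚ; mkℚ; _/_; 0ℚ; 1ℚ; ½; floor; toℚᵘ)
import Data.Rational.Properties as ℚ
open import Data.Rational.Unnormalised as ℚᵘ using (mkℚᵘ; *≡*; *≤*; *<*)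
import Data.Rational.Unnormalised.Properties as ℚᵘ
open import Data.Rational.Solver using (module +-*-Solver)
open import Data.Fin using (Fin; toℕ; fromℕ<)
import Data.Fin.Properties as Fin
open import Data.Fin.Permutation as Perm using (Permutation; permutation)
open import Algebra.Properties.CommutativeMonoid.Sum ℕ.+-0-commutativeMonoid
  using (sum; sum-cong-≗; ∑-distrib-+; ∑-permute)
open import Data.List using (length; filter; applyUpTo)
open import Data.List.Properties using (length-applyUpTo)
open import Relation.Nullary using (¬_; Dec; yes; no; contradiction)
open import Relation.Nullary.Decidable using (_⊎-dec_)
open import Relation.Unary using (Pred; Decidable)
open import Relation.Binary.PropositionalEquality
  using (_≡_; refl; sym; trans; cong; cong₂; subst; subst₂; module ≡-Reasoning)

private
  variable
    ℓ ℓ′ : Level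
    A : Set ℓ
    B : Set ℓ′
    P : Pred ℕ ℓ
    Q : Pred ℕ ℓ′

-- Counting

indicator : Dec A → ℕ
indicator (yes _) = 1
indicator (no _)  = 0

indicator-cong : A ⇔ B → (A? : Dec A) (B? : Dec B) → indicator A? ≡ indicator B?
indicator-cong A⇔B (yes _) (yes _) = refl
indicator-cong A⇔B (yes a) (no ¬b) = contradiction (Equivalence.to A⇔B a) ¬b
indicator-cong A⇔B (no ¬a) (yes b) = contradiction (Equivalence.from A⇔B b) ¬a
indicator-cong A⇔B (no _)  (no _)  = refl

indicator-mono : (A → B) → (A? : Dec A) (B? : Dec B) → indicator A? ≤ indicator B?
indicator-mono A→B (yes a) (no ¬b) = contradiction (A→B a) ¬b
indicator-mono A→B (yes _) (yes _) = ℕ.≤-refl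
indicator-mono A→B (no _)  _       = z≤n

indicator-⊎ : (A → ¬ B) → (A? : Dec A) (B? : Dec B) →
              indicator (A? ⊎-dec B?) ≡ indicator A? + indicator B?
indicator-⊎ A→¬B (yes a) (yes b) = contradiction b (A→¬B a)
indicator-⊎ A→¬B (yes _) (no _)  = refl
indicator-⊎ A→¬B (no _)  (yes _) = refl
indicator-⊎ A→¬B (no _)  (no _)  = refl

count : Decidable P → ℕ → ℕ
count P? n = sum {n} λ i → indicator (P? (toℕ i))

count-cong : (P? : Decidable P) (Q? : Decidable Q) → ∀ n → (∀ i → i < n → P i ⇔ Q i) →
             count P? n ≡ count Q? n
count-cong P? Q? n P⇔Q =
  sum-cong-≗ {n} λ i → indicator-cong (P⇔Q (toℕ i) (Fin.toℕ<n i)) (P? (toℕ i)) (Q? (toℕ i))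

count-mono : (P? : Decidable P) (Q? : Decidable Q) → ∀ n → (∀ i → i < n → P i → Q i) →
             count P? n ≤ count Q? n
count-mono P? Q? zero    P⇒Q = z≤n
count-mono P? Q? (suc n) P⇒Q = ℕ.+-mono-≤ (indicator-mono (P⇒Q 0 (s≤s z≤n)) (P? 0) (Q? 0))
  (count-mono (P? ∘ suc) (Q? ∘ suc) n λ i i<n → P⇒Q (suc i) (s≤s i<n))

count-⊎ : (P? : Decidable P) (Q? : Decidable Q) → ∀ n → (∀ i → i < n → P i → ¬ Q i) →
          count (λ i → P? i ⊎-dec Q? i) n ≡ count P? n + count Q? n
count-⊎ P? Q? n P⇒¬Q = trans
  (sum-cong-≗ {n} λ i → indicator-⊎ (P⇒¬Q (toℕ i) (Fin.toℕ<n i)) (P? (toℕ i)) (Q? (toℕ i)))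
  (∑-distrib-+ {n} (λ i → indicator (P? (toℕ i))) (λ i → indicator (Q? (toℕ i))))

count-< : ∀ m n → count (_<? m) n ≡ n ⊓ m
count-< m       zero    = refl
count-< zero    (suc n) = trans (count-cong (λ i → suc i <? 0) (_<? 0) n λ _ _ → mk⇔ (λ ()) (λ ()))
                                (trans (count-< 0 n) (ℕ.⊓-zeroʳ n))
count-< (suc m) (suc n) = cong suc (trans
  (count-cong (λ i → suc i <? suc m) (_<? m) n λ _ _ → mk⇔ ℕ.s<s⁻¹ s≤s) (count-< m n))

count-reverse : (P? : Decidable P) → ∀ n → count (λ i → P? (n ∸ suc i)) n ≡ count P? n
count-reverse P? n = sym (trans (∑-permute (λ i → indicator (P? (toℕ i))) (Perm.reverse {n}))
  (sum-cong-≗ {n} λ i → cong (λ j → indicator (P? j)) (Fin.opposite-prop i)))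

length-filter-applyUpTo : (P? : Decidable P) (f : ℕ → ℕ) → ∀ n →
                          length (filter P? (applyUpTo f n)) ≡ count (P? ∘ f) n
length-filter-applyUpTo P? f zero = refl
length-filter-applyUpTo P? f (suc n) with P? (f 0)
... | yes _ = cong suc (length-filter-applyUpTo P? (f ∘ suc) n)
... | no _  = length-filter-applyUpTo P? (f ∘ suc) n

Pr-applyUpTo : ∀ {P : Pred ℕ 0ℓ} (P? : Decidable P) (f : ℕ → ℕ) n .{{_ : NonZero n}} →
               Pr (applyUpTo f n) P P? ≡ + count (P? ∘ f) n / n
Pr-applyUpTo P? f (suc n) rewrite length-applyUpTo (f ∘ suc) n =
  cong (λ c → + c / suc n) (length-filter-applyUpTo P? f (suc n))

-- Fractions and the distance to the nearest integer

toℚᵘ-m/n : ∀ m n → toℚᵘ (+ m / suc n) ℚᵘ.≃ mkℚᵘ (+ m) n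
toℚᵘ-m/n m n = ℚ.toℚᵘ-fromℚᵘ (mkℚᵘ (+ m) n)

toℚᵘ≃⇒≡m/n : ∀ p m n → toℚᵘ p ℚᵘ.≃ mkℚᵘ (+ m) n → p ≡ + m / suc n
toℚᵘ≃⇒≡m/n p m n p≃m/n = ℚ.toℚᵘ-injective (ℚᵘ.≃-trans p≃m/n (ℚᵘ.≃-sym (toℚᵘ-m/n m n)))

m/n≤o/p⇔m*p≤o*n : ∀ m n o p .{{_ : NonZero n}} .{{_ : NonZero p}} →
                  (+ m / n ℚ.≤ + o / p) ⇔ (m * p ≤ o * n)
m/n≤o/p⇔m*p≤o*n m (suc n) o (suc p) = mk⇔
  (λ m/n≤o/p → unfold (ℚᵘ.≤-respˡ-≃ (toℚᵘ-m/n m n) (ℚᵘ.≤-respʳ-≃ (toℚᵘ-m/n o p)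
                 (ℚ.toℚᵘ-mono-≤ m/n≤o/p))))
  (λ mp≤on → ℚ.toℚᵘ-cancel-≤ (ℚᵘ.≤-respˡ-≃ (ℚᵘ.≃-sym (toℚᵘ-m/n m n))
               (ℚᵘ.≤-respʳ-≃ (ℚᵘ.≃-sym (toℚᵘ-m/n o p)) (fold mp≤on))))
  where
  fold : m * suc p ≤ o * suc n → mkℚᵘ (+ m) n ℚᵘ.≤ mkℚᵘ (+ o) p
  fold mp≤on = *≤* (subst₂ ℤ._≤_ (ℤ.pos-* m (suc p)) (ℤ.pos-* o (suc n)) (+≤+ mp≤on))
  unfold : mkℚᵘ (+ m) n ℚᵘ.≤ mkℚᵘ (+ o) p → m * suc p ≤ o * suc n
  unfold (*≤* le) = ℤ.drop‿+≤+ (subst₂ ℤ._≤_ (sym (ℤ.pos-* m (suc p))) (sym (ℤ.pos-* o (suc n))) le)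

m*p<o*n⇒m/n<o/p : ∀ m n o p .{{_ : NonZero n}} .{{_ : NonZero p}} →
                  m * p < o * n → + m / n ℚ.< + o / p
m*p<o*n⇒m/n<o/p m (suc n) o (suc p) mp<on =
  ℚ.toℚᵘ-cancel-< (ℚᵘ.<-respˡ-≃ (ℚᵘ.≃-sym (toℚᵘ-m/n m n)) (ℚᵘ.<-respʳ-≃ (ℚᵘ.≃-sym (toℚᵘ-m/n o p))
    (*<* (subst₂ ℤ._<_ (ℤ.pos-* m (suc p)) (ℤ.pos-* o (suc n)) (+<+ mp<on)))))

m/1*o/p≡[m*o]/p : ∀ m o p .{{_ : NonZero p}} → (+ m / 1) ℚ.* (+ o / p) ≡ + (m * o) / p
m/1*o/p≡[m*o]/p m o (suc p) = toℚᵘ≃⇒≡m/n _ (m * o) p (ℚᵘ.≃-trans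
  (ℚ.toℚᵘ-homo-* (+ m / 1) (+ o / suc p))
  (ℚᵘ.≃-trans (ℚᵘ.*-cong (toℚᵘ-m/n m 0) (toℚᵘ-m/n o p))
  (*≡* (cong₂ ℤ._*_ (sym (ℤ.pos-* m o)) (cong +_ (sym (ℕ.*-identityˡ (suc p))))))))

1-m/n≡[n∸m]/n : ∀ m n .{{_ : NonZero n}} → m ≤ n → 1ℚ ℚ.- + m / n ≡ + (n ∸ m) / n
1-m/n≡[n∸m]/n m (suc n) m≤n = toℚᵘ≃⇒≡m/n _ (suc n ∸ m) n (ℚᵘ.≃-trans
  (ℚ.toℚᵘ-homo-+ 1ℚ (ℚ.- (+ m / suc n)))
  (ℚᵘ.≃-trans (ℚᵘ.+-congʳ (mkℚᵘ (+ 1) 0) -m/n≃) (*≡* cross)))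
  where
  -m/n≃ : toℚᵘ (ℚ.- (+ m / suc n)) ℚᵘ.≃ mkℚᵘ (ℤ.- + m) n
  -m/n≃ = ℚᵘ.≃-trans (ℚ.toℚᵘ-homo‿- (+ m / suc n)) (ℚᵘ.-‿cong (toℚᵘ-m/n m n))
  normalise : ∀ N M → (+ 1 ℤ.* N ℤ.+ ℤ.- M ℤ.* + 1) ℤ.* N ≡ (N ℤ.- M) ℤ.* N
  normalise = ℤ-Solver.solve-∀
  n∸m≡n-m : + (suc n ∸ m) ≡ + suc n ℤ.- + m
  n∸m≡n-m = sym (trans (ℤ.m-n≡m⊖n (suc n) m) (ℤ.⊖-≥ m≤n))
  cross : (+ 1 ℤ.* + suc n ℤ.+ ℤ.- + m ℤ.* + 1) ℤ.* + suc n ≡ + (suc n ∸ m) ℤ.* + (1 * suc n)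
  cross = trans (normalise (+ suc n) (+ m))
                (cong₂ ℤ._*_ (sym n∸m≡n-m) (cong +_ (sym (ℕ.*-identityˡ (suc n)))))

0≤p⇒p≡m/n : ∀ p → 0ℚ ℚ.≤ p → ∃₂ λ m n → p ≡ + m / suc n
0≤p⇒p≡m/n (mkℚ (+ m) n coprime) _ = m , n , sym (ℚ.normalize-coprime coprime)
0≤p⇒p≡m/n (mkℚ -[1+ _ ] _ _) (ℚ.*≤* ())

floor≡0 : ∀ p → 0ℚ ℚ.≤ p → p ℚ.< 1ℚ → floor p ≡ + 0
floor≡0 (mkℚ (+ a) d _) _ (ℚ.*<* a*1<1*d) =
  trans (ℤ.div-pos-is-/ℕ (+ a) (suc d)) (cong +_ (ℕ.m<n⇒m/n≡0 a<d))
  where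
  a<d : a < suc d
  a<d = ℤ.drop‿+<+ (subst₂ ℤ._<_ (ℤ.*-identityʳ (+ a)) (ℤ.*-identityˡ (+ suc d)) a*1<1*d)
floor≡0 (mkℚ -[1+ _ ] _ _) (ℚ.*≤* ()) _

floor≡-1 : ∀ p → ℚ.- 1ℚ ℚ.≤ p → p ℚ.< 0ℚ → floor p ≡ -[1+ 0 ]
floor≡-1 (mkℚ -[1+ a ] d _) (ℚ.*≤* -d≤-1-a) _ =
  trans (ℤ.div-pos-is-/ℕ -[1+ a ] (suc d)) (-[1+a]/ℕ[1+d] (ℕ.m≤n⇒m<n∨m≡n a≤d))
  where
  a≤d : a ≤ d
  a≤d with subst₂ ℤ._≤_ (ℤ.-1*i≡-i (+ suc d)) (ℤ.*-identityʳ -[1+ a ]) -d≤-1-a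
  ... | -≤- a≤d = a≤d
  -- _/ℕ_ rounds a negative numerator down by branching on whether the division is exact.
  -[1+a]/ℕ[1+d] : a < d ⊎ a ≡ d → -[1+ a ] ℤ./ℕ suc d ≡ -[1+ 0 ]
  -[1+a]/ℕ[1+d] _ with suc a % suc d in eq
  -[1+a]/ℕ[1+d] (inj₁ a<d)  | zero  with () ← trans (sym (ℕ.m<n⇒m%n≡m (s≤s a<d))) eq
  -[1+a]/ℕ[1+d] (inj₂ refl) | zero  = cong (λ n → ℤ.- (+ n)) (ℕ.n/n≡1 (suc a))
  -[1+a]/ℕ[1+d] (inj₁ a<d)  | suc _ = cong -[1+_] (ℕ.m<n⇒m/n≡0 (s≤s a<d))
  -[1+a]/ℕ[1+d] (inj₂ refl) | suc _ with () ← trans (sym (ℕ.n%n≡0 (suc a))) eq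
floor≡-1 (mkℚ (+ a) _ _) _ (ℚ.*<* a*1<0) with subst (ℤ._< + 0) (ℤ.*-identityʳ (+ a)) a*1<0
... | +<+ ()

‖y‖≡y⊓[1-y] : ∀ y → 0ℚ ℚ.< y → y ℚ.< 1ℚ → ‖ y ‖ ≡ y ℚ.⊓ (1ℚ ℚ.- y)
‖y‖≡y⊓[1-y] y 0<y y<1 = cong₂ ℚ._⊓_ mod1-y mod1-[-y]
  where
  mod1-y : mod1 y ≡ y
  mod1-y rewrite floor≡0 y (ℚ.<⇒≤ 0<y) y<1 = ℚ.+-identityʳ y
  mod1-[-y] : mod1 (ℚ.- y) ≡ 1ℚ ℚ.- y
  mod1-[-y] rewrite floor≡-1 (ℚ.- y) (ℚ.neg-antimono-≤ (ℚ.<⇒≤ y<1)) (ℚ.neg-antimono-< 0<y) =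
    ℚ.+-comm (ℚ.- y) 1ℚ

p⊓q≤r⇔p≤r⊎q≤r : ∀ p q r → p ℚ.⊓ q ℚ.≤ r ⇔ (p ℚ.≤ r ⊎ q ℚ.≤ r)
p⊓q≤r⇔p≤r⊎q≤r p q r = mk⇔ split [ ℚ.p≤q⇒p⊓r≤q q , ℚ.p≤q⇒r⊓p≤q p ]
  where
  split : p ℚ.⊓ q ℚ.≤ r → p ℚ.≤ r ⊎ q ℚ.≤ r
  split p⊓q≤r with ℚ.⊓-sel p q
  ... | inj₁ p⊓q≡p = inj₁ (subst (ℚ._≤ r) p⊓q≡p p⊓q≤r)
  ... | inj₂ p⊓q≡q = inj₂ (subst (ℚ._≤ r) p⊓q≡q p⊓q≤r)

‖y‖≤ε⇔y≤ε⊎1-y≤ε : ∀ y ε → 0ℚ ℚ.< y → y ℚ.< 1ℚ → ‖ y ‖ ℚ.≤ ε ⇔ (y ℚ.≤ ε ⊎ 1ℚ ℚ.- y ℚ.≤ ε)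
‖y‖≤ε⇔y≤ε⊎1-y≤ε y ε 0<y y<1 rewrite ‖y‖≡y⊓[1-y] y 0<y y<1 = p⊓q≤r⇔p≤r⊎q≤r y (1ℚ ℚ.- y) ε

y≤ε⇒1-y≰ε : ∀ {y ε} → ε ℚ.< ½ → y ℚ.≤ ε → ¬ (1ℚ ℚ.- y ℚ.≤ ε)
y≤ε⇒1-y≰ε {y} {ε} ε<½ y≤ε 1-y≤ε = ℚ.<-irrefl refl (begin-strict
  1ℚ                ≡⟨ y+[1-y]≡1 y ⟨
  y ℚ.+ (1ℚ ℚ.- y)  ≤⟨ ℚ.+-mono-≤ y≤ε 1-y≤ε ⟩
  ε ℚ.+ ε           <⟨ ℚ.+-mono-< ε<½ ε<½ ⟩
  ½ ℚ.+ ½           ≡⟨⟩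
  1ℚ                ∎)
  where
  open ℚ.≤-Reasoning
  open +-*-Solver
  y+[1-y]≡1 : ∀ y → y ℚ.+ (1ℚ ℚ.- y) ≡ 1ℚ
  y+[1-y]≡1 = solve 1 (λ y → y :+ (con 1ℚ :- y) := con 1ℚ) refl

-- Odd numbers and odd residues

odd : ℕ → ℕ
odd j = 1 + 2 * j

even⊎odd : ∀ n → ∃ λ h → n ≡ 2 * h ⊎ n ≡ odd h
even⊎odd zero = 0 , inj₁ refl
even⊎odd (suc n) with even⊎odd n
... | h , inj₁ refl = h , inj₂ refl
... | h , inj₂ refl = suc h , inj₁ (2+2h≡2[1+h] h)
  where
  2+2h≡2[1+h] : ∀ h → 2 + 2 * h ≡ 2 * suc h
  2+2h≡2[1+h] = solve-∀

2∤x⇒x≡odd : ∀ x → ¬ (2 ∣ x) → ∃ λ x' → x ≡ odd x'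
2∤x⇒x≡odd x 2∤x with even⊎odd x
... | h , inj₁ x≡2h   = contradiction (divides h (trans x≡2h (ℕ.*-comm 2 h))) 2∤x
... | h , inj₂ x≡odd = h , x≡odd

odd%2≡1 : ∀ n → odd n % 2 ≡ 1
odd%2≡1 n = trans (cong (λ k → (1 + k) % 2) (ℕ.*-comm 2 n)) (ℕ.[m+kn]%n≡m%n 1 n 2)

m<n⇒odd-m<2n : ∀ {m n} → m < n → odd m < 2 * n
m<n⇒odd-m<2n {m} {n} m<n = subst (_≤ 2 * n) (2[1+m]≡2+2m m) (ℕ.*-monoʳ-≤ 2 m<n)
  where
  2[1+m]≡2+2m : ∀ m → 2 * suc m ≡ 2 + 2 * m
  2[1+m]≡2+2m = solve-∀

2n∸odd-m≡odd[n∸1+m] : ∀ {m n} → m < n → 2 * n ∸ odd m ≡ odd (n ∸ suc m)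
2n∸odd-m≡odd[n∸1+m] {m} {n} m<n = begin
  2 * n ∸ odd m                ≡⟨ cong (λ k → 2 * k ∸ odd m) (ℕ.m+[n∸m]≡n m<n) ⟨
  2 * (suc m + t) ∸ odd m      ≡⟨ cong (_∸ odd m) (regroup m t) ⟩
  odd m + odd t ∸ odd m        ≡⟨ ℕ.m+n∸m≡n (odd m) (odd t) ⟩
  odd t                        ∎
  where
  open ≡-Reasoning
  t = n ∸ suc m
  regroup : ∀ m t → 2 * (suc m + t) ≡ (1 + 2 * m) + (1 + 2 * t)
  regroup = solve-∀

m*n≤o⇒m≤o/n : ∀ m n o .{{_ : NonZero n}} → m * n ≤ o → m ≤ o ℕ./ n
m*n≤o⇒m≤o/n m n o mn≤o = subst (_≤ o ℕ./ n) (ℕ.m*n/n≡m m n) (ℕ./-monoˡ-≤ n mn≤o)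

-- Hensel lifting: for odd q, adding 2 ^ l to y' clears the next binary digit of the product.
odd-inverse : ∀ x' l → ∃₂ λ y' q → odd x' * odd y' ≡ 1 + q * 2 ^ suc l
odd-inverse x' zero = 0 , x' , base x'
  where
  base : ∀ x' → (1 + 2 * x') * (1 + 2 * 0) ≡ 1 + x' * (2 * 1)
  base = solve-∀
odd-inverse x' (suc l) with odd-inverse x' l
... | y' , q , eq with even⊎odd q
...   | h , inj₁ refl = y' , h , trans eq (regroup h (2 ^ l))
  where
  regroup : ∀ h P → 1 + 2 * h * (2 * P) ≡ 1 + h * (2 * (2 * P))
  regroup = solve-∀
...   | h , inj₂ refl = y' + 2 ^ l , 1 + h + x' , (begin
  odd x' * odd (y' + 2 ^ l)                              ≡⟨ split x' y' (2 ^ l) ⟩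
  odd x' * odd y' + odd x' * (2 * 2 ^ l)                 ≡⟨ cong (_+ odd x' * (2 * 2 ^ l)) eq ⟩
  1 + odd h * (2 * 2 ^ l) + odd x' * (2 * 2 ^ l)         ≡⟨ merge x' h (2 ^ l) ⟩
  1 + (1 + h + x') * (2 * (2 * 2 ^ l))                   ∎)
  where
  open ≡-Reasoning
  split : ∀ x' y' P → (1 + 2 * x') * (1 + 2 * (y' + P))
                     ≡ (1 + 2 * x') * (1 + 2 * y') + (1 + 2 * x') * (2 * P)
  split = solve-∀
  merge : ∀ x' h P → 1 + (1 + 2 * h) * (2 * P) + (1 + 2 * x') * (2 * P) ≡ 1 + (1 + h + x') * (2 * (2 * P))
  merge = solve-∀

module OddResidues (M : ℕ) .{{_ : NonZero M}} where

  private
    N = 2 * M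
    instance
      N≢0 : NonZero N
      N≢0 = ℕ.m*n≢0 2 M

  [m%N*o]%N≡[m*o]%N : ∀ m o → (m % N * o) % N ≡ (m * o) % N
  [m%N*o]%N≡[m*o]%N m o = begin
    (m % N * o) % N            ≡⟨ ℕ.%-distribˡ-* (m % N) o N ⟩
    (m % N % N * (o % N)) % N  ≡⟨ cong (λ k → (k * (o % N)) % N) (ℕ.m%n%n≡m%n m N) ⟩
    (m % N * (o % N)) % N      ≡⟨ ℕ.%-distribˡ-* m o N ⟨
    (m * o) % N                ∎
    where open ≡-Reasoning

  v%2≡1⇒v%N≡odd : ∀ v → v % 2 ≡ 1 → v % N ≡ odd (v % N ℕ./ 2)
  v%2≡1⇒v%N≡odd v v%2≡1 = begin
    w                      ≡⟨ ℕ.m≡m%n+[m/n]*n w 2 ⟩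
    w % 2 + w ℕ./ 2 * 2    ≡⟨ cong₂ _+_ w%2≡1 (ℕ.*-comm (w ℕ./ 2) 2) ⟩
    odd (w ℕ./ 2)          ∎
    where
    open ≡-Reasoning
    w = v % N
    w%2≡1 : w % 2 ≡ 1
    w%2≡1 = trans (ℕ.m∣n⇒o%n%m≡o%m 2 N v (divides M (ℕ.*-comm 2 M))) v%2≡1

  oddMul : ℕ → ℕ → ℕ
  oddMul x' i = odd i * odd x' % N ℕ./ 2

  oddMul-spec : ∀ x' i → odd i * odd x' % N ≡ odd (oddMul x' i)
  oddMul-spec x' i = v%2≡1⇒v%N≡odd _ (begin
    odd i * odd x' % 2                    ≡⟨ ℕ.%-distribˡ-* (odd i) (odd x') 2 ⟩
    (odd i % 2 * (odd x' % 2)) % 2        ≡⟨ cong₂ (λ a b → (a * b) % 2) (odd%2≡1 i) (odd%2≡1 x') ⟩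
    1                                     ∎)
    where open ≡-Reasoning

  oddMul<M : ∀ x' i → oddMul x' i < M
  oddMul<M x' i = ℕ.*-cancelˡ-< 2 _ _ (ℕ.<-trans (ℕ.n<1+n _)
    (subst (_< N) (oddMul-spec x' i) (ℕ.m%n<n _ N)))

  oddMul-inverse : ∀ x' y' q → odd x' * odd y' ≡ 1 + q * N →
                   ∀ i → i < M → oddMul y' (oddMul x' i) ≡ i
  oddMul-inverse x' y' q xy≡1 i i<M = ℕ.*-cancelˡ-≡ _ _ 2 (ℕ.suc-injective (begin
    odd (oddMul y' (oddMul x' i))      ≡⟨ oddMul-spec y' (oddMul x' i) ⟨
    odd (oddMul x' i) * odd y' % N     ≡⟨ cong (λ k → k * odd y' % N) (oddMul-spec x' i) ⟨
    (odd i * odd x' % N) * odd y' % N  ≡⟨ [m%N*o]%N≡[m*o]%N (odd i * odd x') (odd y') ⟩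
    odd i * odd x' * odd y' % N        ≡⟨ cong (_% N) (ℕ.*-assoc (odd i) (odd x') (odd y')) ⟩
    odd i * (odd x' * odd y') % N      ≡⟨ cong (λ k → odd i * k % N) xy≡1 ⟩
    odd i * (1 + q * N) % N            ≡⟨ cong (_% N) (distrib (odd i) q N) ⟩
    (odd i + odd i * q * N) % N        ≡⟨ ℕ.[m+kn]%n≡m%n (odd i) (odd i * q) N ⟩
    odd i % N                          ≡⟨ ℕ.m<n⇒m%n≡m (m<n⇒odd-m<2n i<M) ⟩
    odd i                              ∎))
    where
    open ≡-Reasoning
    distrib : ∀ a q N → a * (1 + q * N) ≡ a + a * q * N
    distrib = solve-∀

  module _ (x' y' q : ℕ) (xy≡1 : odd x' * odd y' ≡ 1 + q * N) where

    oddMul-permutation : Permutation M M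
    oddMul-permutation = permutation (oddMulFin x') (oddMulFin y') (inverse y' x' yx≡1) (inverse x' y' xy≡1)
      where
      oddMulFin : ℕ → Fin M → Fin M
      oddMulFin z i = fromℕ< (oddMul<M z (toℕ i))
      yx≡1 : odd y' * odd x' ≡ 1 + q * N
      yx≡1 = trans (ℕ.*-comm (odd y') (odd x')) xy≡1
      inverse : ∀ u' v' → odd u' * odd v' ≡ 1 + q * N → ∀ i → oddMulFin v' (oddMulFin u' i) ≡ i
      inverse u' v' uv≡1 i = Fin.toℕ-injective (begin
        toℕ (oddMulFin v' (oddMulFin u' i))  ≡⟨ Fin.toℕ-fromℕ< (oddMul<M v' (toℕ (oddMulFin u' i))) ⟩
        oddMul v' (toℕ (oddMulFin u' i))     ≡⟨ cong (oddMul v') (Fin.toℕ-fromℕ< (oddMul<M u' (toℕ i))) ⟩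
        oddMul v' (oddMul u' (toℕ i))        ≡⟨ oddMul-inverse u' v' q uv≡1 (toℕ i) (Fin.toℕ<n i) ⟩
        toℕ i                                ∎)
        where open ≡-Reasoning

    count-odd*x : (Q? : Decidable Q) → count (λ i → Q? (odd i * odd x' % N)) M ≡ count (Q? ∘ odd) M
    count-odd*x Q? = trans
      (sum-cong-≗ {M} λ i → cong (λ r → indicator (Q? r)) (trans (oddMul-spec x' (toℕ i))
        (cong odd (sym (Fin.toℕ-fromℕ< (oddMul<M x' (toℕ i)))))))
      (sym (∑-permute (λ j → indicator (Q? (odd (toℕ j)))) oddMul-permutation))

-- The probability of the event

module _ (l : ℕ) (ε : ℚ) where

  private
    M = 2 ^ l
    instance
      M≢0 : NonZero M
      M≢0 = ℕ.m^n≢0 2 l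
      2M≢0 : NonZero (2 * M)
      2M≢0 = ℕ.m*n≢0 2 M

  Near : Pred ℕ 0ℓ
  Near r = ‖ + r / (2 * M) ‖ ℚ.≤ ε

  near? : Decidable Near
  near? r = ‖ + r / (2 * M) ‖ ℚ.≤? ε

  Below : Pred ℕ 0ℓ
  Below j = + odd j / (2 * M) ℚ.≤ ε

  below? : Decidable Below
  below? j = + odd j / (2 * M) ℚ.≤? ε

  1-odd/2M≡odd-mirror/2M : ∀ {j} → j < M → 1ℚ ℚ.- + odd j / (2 * M) ≡ + odd (M ∸ suc j) / (2 * M)
  1-odd/2M≡odd-mirror/2M {j} j<M =
    trans (1-m/n≡[n∸m]/n (odd j) (2 * M) (ℕ.<⇒≤ (m<n⇒odd-m<2n j<M)))
          (cong (λ k → + k / (2 * M)) (2n∸odd-m≡odd[n∸1+m] j<M))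

  near-odd⇔below⊎below-mirror : ∀ j → j < M → Near (odd j) ⇔ (Below j ⊎ Below (M ∸ suc j))
  near-odd⇔below⊎below-mirror j j<M =
    subst (λ z → Near (odd j) ⇔ (Below j ⊎ z ℚ.≤ ε)) (1-odd/2M≡odd-mirror/2M j<M)
      (‖y‖≤ε⇔y≤ε⊎1-y≤ε (+ odd j / (2 * M)) ε
        (m*p<o*n⇒m/n<o/p 0 1 (odd j) (2 * M) (s≤s z≤n))
        (m*p<o*n⇒m/n<o/p (odd j) (2 * M) 1 1
          (subst₂ _<_ (sym (ℕ.*-identityʳ (odd j))) (sym (ℕ.*-identityˡ (2 * M))) (m<n⇒odd-m<2n j<M))))

  count-near-odd : ε ℚ.< ½ → count (near? ∘ odd) M ≡ count below? M + count below? M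
  count-near-odd ε<½ = begin
    count (near? ∘ odd) M                       ≡⟨ count-cong (near? ∘ odd) below-or-mirror? M
                                                     near-odd⇔below⊎below-mirror ⟩
    count below-or-mirror? M                    ≡⟨ count-⊎ below? mirror? M disjoint ⟩
    count below? M + count mirror? M            ≡⟨ cong (_+_ (count below? M)) (count-reverse below? M) ⟩
    count below? M + count below? M             ∎
    where
    open ≡-Reasoning
    mirror? : Decidable (λ j → Below (M ∸ suc j))
    mirror? j = below? (M ∸ suc j)
    below-or-mirror? : Decidable (λ j → Below j ⊎ Below (M ∸ suc j))
    below-or-mirror? j = below? j ⊎-dec mirror? j
    disjoint : ∀ j → j < M → Below j → ¬ Below (M ∸ suc j)
    disjoint j j<M below = y≤ε⇒1-y≰ε ε<½ below ∘ subst (ℚ._≤ ε) (sym (1-odd/2M≡odd-mirror/2M j<M))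

  count-below*D≤e*2M : ∀ e D .{{_ : NonZero D}} → ε ≡ + e / D → count below? M * D ≤ e * (2 * M)
  count-below*D≤e*2M e D ε≡e/D = begin
    count below? M * D       ≤⟨ ℕ.*-monoˡ-≤ D count≤ ⟩
    e * (2 * M) ℕ./ D * D    ≤⟨ ℕ.m/n*n≤m (e * (2 * M)) D ⟩
    e * (2 * M)              ∎
    where
    open ℕ.≤-Reasoning
    below⇒< : ∀ j → j < M → Below j → j < e * (2 * M) ℕ./ D
    below⇒< j _ below = m*n≤o⇒m≤o/n (suc j) D (e * (2 * M))
      (ℕ.≤-trans (ℕ.*-monoˡ-≤ D (s≤s (ℕ.m≤m+n j (j + 0))))
                 (Equivalence.to (m/n≤o/p⇔m*p≤o*n (odd j) (2 * M) e D) (subst (_ ℚ.≤_) ε≡e/D below)))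
    count≤ : count below? M ≤ e * (2 * M) ℕ./ D
    count≤ = ℕ.≤-trans (count-mono below? (_<? e * (2 * M) ℕ./ D) M below⇒<)
                       (ℕ.≤-trans (ℕ.≤-reflexive (count-< _ M)) (ℕ.m⊓n≤n M _))

  count-below≡k : ∀ k → ε ≡ + k / M → k ≤ M → count below? M ≡ k
  count-below≡k k ε≡k/M k≤M = begin
    count below? M   ≡⟨ count-cong below? (_<? k) M below⇔< ⟩
    count (_<? k) M  ≡⟨ count-< k M ⟩
    M ⊓ k            ≡⟨ ℕ.m≥n⇒m⊓n≡n k≤M ⟩
    k                ∎
    where
    open ≡-Reasoning
    regroup : ∀ k M → k * (2 * M) ≡ 2 * k * M
    regroup = solve-∀
    below⇔< : ∀ j → j < M → Below j ⇔ j < k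
    below⇔< j _ = mk⇔
      (λ below → ℕ.*-cancelˡ-< 2 j k (ℕ.*-cancelʳ-≤ (odd j) (2 * k) M
        (subst (odd j * M ≤_) (regroup k M) (Equivalence.to cross (subst (_ ℚ.≤_) ε≡k/M below)))))
      (λ j<k → subst (_ ℚ.≤_) (sym ε≡k/M) (Equivalence.from cross
        (subst (odd j * M ≤_) (sym (regroup k M)) (ℕ.*-monoˡ-≤ M (ℕ.<⇒≤ (m<n⇒odd-m<2n j<k))))))
      where
      cross : (+ odd j / (2 * M) ℚ.≤ + k / M) ⇔ (odd j * M ≤ k * (2 * M))
      cross = m/n≤o/p⇔m*p≤o*n (odd j) (2 * M) k M

  -- let rather than with: abstracting over the goal would normalise PrEvent, which is prohibitively slow.
  PrEvent≡2count-below/M : ∀ x → ¬ (2 ∣ x) → ε ℚ.< ½ →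
                           PrEvent (suc l) x ε ≡ + (count below? M + count below? M) / M
  PrEvent≡2count-below/M x 2∤x ε<½ =
    let x' , x≡odd = 2∤x⇒x≡odd x 2∤x ; y' , q , xy≡1 = odd-inverse x' l in begin
    PrEvent (suc l) x ε                              ≡⟨ cong (λ z → PrEvent (suc l) z ε) x≡odd ⟩
    PrEvent (suc l) (odd x') ε                       ≡⟨ Pr-applyUpTo (event? (suc l) (odd x') ε) odd M ⟩
    + count (λ i → near? (odd i * odd x' % (2 * M))) M / M
                                                     ≡⟨ cong (λ c → + c / M) (count-odd*x x' y' q xy≡1 near?) ⟩
    + count (near? ∘ odd) M / M                      ≡⟨ cong (λ c → + c / M) (count-near-odd ε<½) ⟩
    + (count below? M + count below? M) / M          ∎
    where
    open ≡-Reasoning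
    open OddResidues M using (count-odd*x)

  PrEvent≤4ε : ∀ x → ¬ (2 ∣ x) → 0ℚ ℚ.≤ ε → ε ℚ.< ½ → PrEvent (suc l) x ε ℚ.≤ (+ 4 / 1) ℚ.* ε
  PrEvent≤4ε x 2∤x 0≤ε ε<½ = let e , D , ε≡e/D = 0≤p⇒p≡m/n ε 0≤ε in
    subst₂ ℚ._≤_ (sym (PrEvent≡2count-below/M x 2∤x ε<½))
      (trans (sym (m/1*o/p≡[m*o]/p 4 e (suc D))) (cong (+ 4 / 1 ℚ.*_) (sym ε≡e/D)))
      (Equivalence.from (m/n≤o/p⇔m*p≤o*n (c + c) M (4 * e) (suc D)) (begin
        (c + c) * suc D      ≡⟨ double c (suc D) ⟩
        2 * (c * suc D)      ≤⟨ ℕ.*-monoʳ-≤ 2 (count-below*D≤e*2M e (suc D) ε≡e/D) ⟩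
        2 * (e * (2 * M))    ≡⟨ regroup e M ⟩
        4 * e * M            ∎))
    where
    open ℕ.≤-Reasoning
    c = count below? M
    double : ∀ c D → (c + c) * D ≡ 2 * (c * D)
    double = solve-∀
    regroup : ∀ e M → 2 * (e * (2 * M)) ≡ 4 * e * M
    regroup = solve-∀

  PrEvent≡2ε : ∀ x → ¬ (2 ∣ x) → ε ℚ.< ½ → (∃ λ k → ε ≡ + k / M) → PrEvent (suc l) x ε ≡ (+ 2 / 1) ℚ.* ε
  PrEvent≡2ε x 2∤x ε<½ (k , ε≡k/M) = begin
    PrEvent (suc l) x ε                       ≡⟨ PrEvent≡2count-below/M x 2∤x ε<½ ⟩
    + (count below? M + count below? M) / M   ≡⟨ cong (λ c → + (c + c) / M) (count-below≡k k ε≡k/M k≤M) ⟩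
    + (k + k) / M                             ≡⟨ cong (λ n → + (k + n) / M) (ℕ.+-identityʳ k) ⟨
    + (2 * k) / M                             ≡⟨ m/1*o/p≡[m*o]/p 2 k M ⟨
    (+ 2 / 1) ℚ.* (+ k / M)                   ≡⟨ cong (+ 2 / 1 ℚ.*_) ε≡k/M ⟨
    (+ 2 / 1) ℚ.* ε                           ∎
    where
    open ≡-Reasoning
    ε≤1 : ε ℚ.≤ 1ℚ
    ε≤1 = ℚ.≤-trans (ℚ.<⇒≤ ε<½) (Equivalence.from (m/n≤o/p⇔m*p≤o*n 1 2 1 1) (s≤s z≤n))
    k≤M : k ≤ M
    k≤M = subst₂ _≤_ (ℕ.*-identityʳ k) (ℕ.*-identityˡ M)
            (Equivalence.to (m/n≤o/p⇔m*p≤o*n k M 1 1) (subst (ℚ._≤ 1ℚ) ε≡k/M ε≤1))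

-- Only the oddness of x matters.
lemma8 : (ℓ n x : ℕ) → .{{NonZero ℓ}} → n ≤ 2 ^ ℓ →
    ¬ (2 ∣ x) → 0 < x → x < n →
    (ε : ℚ) → 0ℚ ℚ.≤ ε → ε ℚ.< ½ →
    (PrEvent ℓ x ε ℚ.≤ (+ 4 / 1) ℚ.* ε)
    × ((∃ λ k → ε ≡ _/_ (+ k) (2 ^ (ℓ ℕ.∸ 1)) {{ℕ.m^n≢0 2 (ℓ ℕ.∸ 1)}}) →
       PrEvent ℓ x ε ≡ (+ 2 / 1) ℚ.* ε)
lemma8 (suc l) _ x _ 2∤x _ _ ε 0≤ε ε<½ = PrEvent≤4ε l ε x 2∤x 0≤ε ε<½ , PrEvent≡2ε l ε x 2∤x ε<½
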